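{- There is a constant $c'$ such that for all positive integers $k$, $R(3,k)\le \operatorname{gr}(AC_6,K_k)\le c'k^3$.
   Context: $R(3,k)$ is the classical graph Ramsey number: the least $n$ such that every graph on $n$ vertices contains a triangle or an independent set of size $k$. A grid subgraph on $c$ columns and $r$ rows is a graph whose vertex set is a subset of $[c]\times[r]$ (vertex $(x,y)$ in column $x$, row $y$) and whose edges each join two vertices in the same row or the same column. $G_{N\times N}=K_N\square K_N$; a spanning grid subgraph is a spanning subgraph of it. An embedding of $H$ (on $c_H$ columns, $r_H$ rows) into $G$ is a pair of injections $\varphi_c:[c_H]\to[N]$, $\varphi_r:[r_H]\to[N]$ sending each edge $\{(x,y),(x',y')\}$ of $H$ to an edge $\{(\varphi_c(x),\varphi_r(y)),(\varphi_c(x'),\varphi_r(y'))\}$ of $G$; $G$ contains $H$ if one exists. A coclique of size $k$ is a set of $k$ pairwise non-adjacent vertices all in one row or all in one column. $\operatorname{gr}(H,K_k)$ is the least $N$ such that every spanning grid subgraph of $G_{N\times N}$ contains $H$ or a coclique of size $k$. $AC_6$ is the grid subgraph on $3$ columns and $3$ rows which is the $6$-cycle through $(1,1),(2,1),(2,2),(3,2),(3,3),(1,3)$ in this order. -}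

module Defs where

open import Data.Nat using (ℕ; _<_)
open import Data.Fin using (Fin; zero; suc)
open import Data.Bool using (Bool; true; false)
open import Data.Product using (Σ; _×_; _,_; ∃; ∃-syntax; proj₁; proj₂)
open import Data.Sum using (_⊎_)
open import Data.List using (List; []; _∷_)
open import Data.List.Relation.Unary.All using (All)
open import Relation.Nullary using (¬_)
open import Relation.Binary.PropositionalEquality using (_≡_)
open import Function.Definitions using (Injective)

IsLeast : (ℕ → Set) → ℕ → Set
IsLeast P n = P n × (∀ m → m < n → ¬ P m)

record SimpleGraph (n : ℕ) : Set where
  field
    adj    : Fin n → Fin n → Bool
    sym    : ∀ u v → adj u v ≡ adj v u
    irrefl : ∀ u → adj u u ≡ false
open SimpleGraph public

HasTriangle : ∀ {n} → SimpleGraph n → Set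
HasTriangle G =
  ∃[ a ] ∃[ b ] ∃[ c ] (adj G a b ≡ true × adj G b c ≡ true × adj G a c ≡ true)

HasIndependentSet : ∀ {n} → SimpleGraph n → ℕ → Set
HasIndependentSet {n} G k =
  Σ (Fin k → Fin n) λ f → Injective _≡_ _≡_ f ×
    (∀ i j → ¬ (i ≡ j) → adj G (f i) (f j) ≡ false)

RamseyProp : ℕ → ℕ → Set
RamseyProp k n = (G : SimpleGraph n) → HasTriangle G ⊎ HasIndependentSet G k

IsR3 : ℕ → ℕ → Set
IsR3 k r = IsLeast (RamseyProp k) r

-- Grids.  Cell c r = column index × row index.

Cell : ℕ → ℕ → Set
Cell c r = Fin c × Fin r

-- Spanning subgraph of G_{N×N} = K_N □ K_N
record SpanningGrid (N : ℕ) : Set where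
  field
    gadj    : Cell N N → Cell N N → Bool
    gsym    : ∀ u v → gadj u v ≡ gadj v u
    girrefl : ∀ u → gadj u u ≡ false
    gline   : ∀ u v → gadj u v ≡ true →
              (proj₁ u ≡ proj₁ v) ⊎ (proj₂ u ≡ proj₂ v)
open SpanningGrid public

-- A grid subgraph H on c columns and r rows, given by its edge list
-- (only edges matter for embeddings).
GridEdges : ℕ → ℕ → Set
GridEdges c r = List (Cell c r × Cell c r)

Embeds : ∀ {c r N} → GridEdges c r → SpanningGrid N → Set
Embeds {c} {r} {N} H G =
  Σ (Fin c → Fin N) λ φc → Σ (Fin r → Fin N) λ φr →
    Injective _≡_ _≡_ φc × Injective _≡_ _≡_ φr ×
    All (λ e → gadj G (φc (proj₁ (proj₁ e)) , φr (proj₂ (proj₁ e)))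
                      (φc (proj₁ (proj₂ e)) , φr (proj₂ (proj₂ e))) ≡ true) H

HasCoclique : ∀ {N} → SpanningGrid N → ℕ → Set
HasCoclique {N} G k =
  (Σ (Fin N) λ y → Σ (Fin k → Fin N) λ f → Injective _≡_ _≡_ f ×
     (∀ i j → ¬ (i ≡ j) → gadj G (f i , y) (f j , y) ≡ false))
  ⊎
  (Σ (Fin N) λ x → Σ (Fin k → Fin N) λ f → Injective _≡_ _≡_ f ×
     (∀ i j → ¬ (i ≡ j) → gadj G (x , f i) (x , f j) ≡ false))

GrProp : ∀ {c r} → GridEdges c r → ℕ → ℕ → Set
GrProp H k N = (G : SpanningGrid N) → Embeds H G ⊎ HasCoclique G k

IsGr : ∀ {c r} → GridEdges c r → ℕ → ℕ → Set
IsGr H k g = IsLeast (GrProp H k) g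

-- AC_6: 6-cycle (1,1),(2,1),(2,2),(3,2),(3,3),(1,3) on 3 columns, 3 rows
-- (1-based coordinates in the paper; Fin 3 uses 0,1,2)

private
  f0 f1 f2 : Fin 3
  f0 = zero
  f1 = suc zero
  f2 = suc (suc zero)

AC6 : GridEdges 3 3
AC6 = ((f0 , f0) , (f1 , f0))
    ∷ ((f1 , f0) , (f1 , f1))
    ∷ ((f1 , f1) , (f2 , f1))
    ∷ ((f2 , f1) , (f2 , f2))
    ∷ ((f2 , f2) , (f0 , f2))
    ∷ ((f0 , f2) , (f0 , f0))
    ∷ []

{-# OPTIONS --safe #-}
-- R(3,k) ≤ gr(AC6,K_k): the Cartesian square G □ G of a graph G is a spanning grid whose rows and
-- columns are copies of G, so an AC6 in it yields a triangle of G and a coclique an independent set.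
--
-- gr(AC6,K_k) = O(k³): let G be an N × N grid without AC6 (a "hexagon") in which every row and
-- column has independence number m < k, and count the cherries (x,ρ) — (x,y) — (c,y).  Greedily, a
-- line has at most dm vertices of degree below d, so all but 2Ndm vertices have both degrees at
-- least d and there are at least N²d² − 2mNd³ cherries.  For fixed ends ρ and c, the centres (x,y)
-- split into independent sets of column c (one for each x) and of row ρ (one for each y: an edge of
-- row ρ between two such centres closes a hexagon), so there are at most 2mN³ cherries.  For
-- d = 16k² + 1 and N = 4kd the two bounds contradict each other.
--
-- Both properties are decidable by exhaustive search, which makes the least numbers exist.
module Submission where

open import Data.Nat using (ℕ; zero; suc; _+_; _*_; _^_; _≤_; _<_; _<ᵇ_; z≤n; s≤s; NonZero)
open import Data.Nat.Properties
  using ( +-0-commutativeMonoid; +-*-semiring; +-comm; +-identityʳ; *-identityˡ; *-zeroʳ; *-suc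
        ; ≤-refl; ≤-reflexive; ≤-trans; <⇒≤; <-≤-trans; ≤-<-trans; ≮⇒≥; <⇒≱; m≤m+n; m≤n+m; m≤m*n
        ; m<m+n; +-mono-≤; +-monoˡ-≤; +-monoʳ-≤; *-mono-≤; *-monoʳ-≤; *-monoʳ-<; +-cancelʳ-<
        ; <ᵇ⇒<; <⇒<ᵇ; anyUpTo?; module ≤-Reasoning)
open import Data.Nat.Induction using (<-rec)
open import Data.Nat.Tactic.RingSolver using (solve-∀)
open import Algebra.Properties.CommutativeMonoid.Sum +-0-commutativeMonoid
  using (sum; sum-syntax; sum-cong-≗; ∑-comm; ∑-distrib-+)
open import Algebra.Properties.Semiring.Sum +-*-semiring using (*-distribˡ-sum; *-distribʳ-sum)
open import Data.Bool using (Bool; true; false; _∧_; _∨_; not; T)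
open import Data.Bool.Properties using (∧-zeroʳ; ∨-identityʳ) renaming (_≟_ to _≟ᵇ_)
open import Data.Fin using (Fin; zero; suc)
open import Data.Fin.Properties using (_≟_; any?; all?)
open import Data.List.Relation.Unary.All using () renaming ([] to []ᴬ; _∷_ to _∷ᴬ_)
open import Data.Product using (∃; ∃-syntax; _×_; _,_; proj₁; proj₂; curry; uncurry)
open import Data.Sum as Sum using (_⊎_; inj₁; inj₂)
open import Data.Vec.Functional using ([]; _∷_)
open import Data.Vec.Functional.Relation.Binary.Pointwise using (Pointwise)
open import Function using (_∘_; id)
open import Function.Definitions using (Injective)
open import Level using (0ℓ)
open import Relation.Binary using (Rel; Reflexive; Symmetric; _Respects_)
open import Relation.Binary.PropositionalEquality
  using (_≡_; refl; sym; trans; cong; subst; subst₂; module ≡-Reasoning)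
open import Relation.Nullary using (¬_; Dec; does; yes; no; contradiction; ¬?)
open import Relation.Nullary.Decidable using (dec-true; map′; _×-dec_; _⊎-dec_; _→-dec_; decidable-stable)
open import Relation.Unary using (Pred; Decidable)

open import Defs hiding (sym)

private variable
  X : Set
  _≈_ : Rel X 0ℓ
  k m n : ℕ

𝟙 : Bool → ℕ
𝟙 true  = 1
𝟙 false = 0

count : (Fin n → Bool) → ℕ
count S = ∑[ i < _ ] 𝟙 (S i)

∑-mono-≤ : ∀ {f g : Fin n → ℕ} → (∀ i → f i ≤ g i) → sum f ≤ sum g
∑-mono-≤ {zero}  f≤g = z≤n
∑-mono-≤ {suc n} f≤g = +-mono-≤ (f≤g zero) (∑-mono-≤ (f≤g ∘ suc))

∑-const : ∀ n c → ∑[ i < n ] c ≡ n * c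
∑-const zero    c = refl
∑-const (suc n) c = cong (c +_) (∑-const n c)

∑-≤-const : ∀ {f : Fin n → ℕ} c → (∀ i → f i ≤ c) → sum f ≤ n * c
∑-≤-const {n} c f≤c = ≤-trans (∑-mono-≤ f≤c) (≤-reflexive (∑-const n c))

∑∑-distrib-+ : ∀ {m} (f g : Fin n → Fin m → ℕ) →
  ∑[ i < n ] ∑[ j < m ] (f i j + g i j) ≡ ∑[ i < n ] ∑[ j < m ] f i j + ∑[ i < n ] ∑[ j < m ] g i j
∑∑-distrib-+ f g = trans (sum-cong-≗ λ i → ∑-distrib-+ (f i) (g i)) (∑-distrib-+ (sum ∘ f) (sum ∘ g))

count>0⇒∃ : ∀ (S : Fin n → Bool) → 0 < count S → ∃ λ i → S i ≡ true
count>0⇒∃ {suc n} S 0<∣S∣ with S zero in S₀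
... | true  = zero , S₀
... | false = let i , Sᵢ = count>0⇒∃ (S ∘ suc) 0<∣S∣ in suc i , Sᵢ

count-singleton : ∀ (v : Fin n) → count (λ u → does (u ≟ v)) ≡ 1
count-singleton {suc n} zero    = cong suc (trans (∑-const n 0) (*-zeroʳ n))
count-singleton {suc n} (suc v) = count-singleton v

𝟙-∧ : ∀ a b → 𝟙 (a ∧ b) ≡ 𝟙 a * 𝟙 b
𝟙-∧ true  b = sym (+-identityʳ (𝟙 b))
𝟙-∧ false b = refl

𝟙-split : ∀ a b → 𝟙 a ≡ 𝟙 (a ∧ not b) + 𝟙 (a ∧ b)
𝟙-split false _     = refl
𝟙-split true  false = refl
𝟙-split true  true  = refl

count-*-count : ∀ {m} (S : Fin n → Bool) (T : Fin m → Bool) →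
                count S * count T ≡ ∑[ i < n ] ∑[ j < m ] 𝟙 (S i ∧ T j)
count-*-count {n} {m} S T = begin
  count S * count T
    ≡⟨ *-distribʳ-sum {n} (count T) (𝟙 ∘ S) ⟩
  ∑[ i < n ] (𝟙 (S i) * count T)
    ≡⟨ sum-cong-≗ (λ i → *-distribˡ-sum {m} (𝟙 (S i)) (𝟙 ∘ T)) ⟩
  ∑[ i < n ] ∑[ j < m ] (𝟙 (S i) * 𝟙 (T j))
    ≡⟨ sum-cong-≗ (λ i → sum-cong-≗ λ j → 𝟙-∧ (S i) (T j)) ⟨
  ∑[ i < n ] ∑[ j < m ] 𝟙 (S i ∧ T j) ∎
  where open ≡-Reasoning

∧-true : ∀ {a b} → a ∧ b ≡ true → a ≡ true × b ≡ true
∧-true {true} {true} _ = refl , refl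

does-true : ∀ {P : Set} (P? : Dec P) → does P? ≡ true → P
does-true (yes p) _ = p

<ᵇ-true : ∀ a b → (a <ᵇ b) ≡ true → a < b
<ᵇ-true a b eq = <ᵇ⇒< a b (subst T (sym eq) _)

<ᵇ-false : ∀ a b → (a <ᵇ b) ≡ false → b ≤ a
<ᵇ-false a b eq = ≮⇒≥ λ a<b → subst T eq (<⇒<ᵇ a<b)

-- Independent sets in graphs given by Boolean adjacency

Adjacency : Set → Set
Adjacency X = X → X → Bool

IsSymmetric : Adjacency X → Set
IsSymmetric A = ∀ u v → A u v ≡ A v u

IsIrreflexive : Adjacency X → Set
IsIrreflexive A = ∀ u → A u u ≡ false

_≐_ : Adjacency X → Adjacency X → Set
A ≐ B = ∀ u v → A u v ≡ B u v

≐-sym : {A B : Adjacency X} → A ≐ B → B ≐ A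
≐-sym A≐B u v = sym (A≐B u v)

IsIndependent : Adjacency (Fin n) → (Fin k → Fin n) → Set
IsIndependent A f = Injective _≡_ _≡_ f × (∀ i j → ¬ i ≡ j → A (f i) (f j) ≡ false)

HasIndependent : Adjacency (Fin n) → ℕ → Set
HasIndependent {n} A k = ∃ λ (f : Fin k → Fin n) → IsIndependent A f

IsIndependentSet : Adjacency (Fin n) → (Fin n → Bool) → Set
IsIndependentSet A S = ∀ u v → S u ≡ true → S v ≡ true → A u v ≡ false

degree : Adjacency (Fin n) → Fin n → ℕ
degree A v = count (A v)

independent-≐ : {A B : Adjacency (Fin n)} → A ≐ B → HasIndependent A k → HasIndependent B k
independent-≐ A≐B (f , f-inj , f-indep) = f , f-inj , λ i j i≢j → trans (sym (A≐B _ _)) (f-indep i j i≢j)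

[]-injective : Injective _≡_ _≡_ ([] {A = X})
[]-injective {x = ()}

∷-injective : ∀ {x} {f : Fin k → X} → Injective _≡_ _≡_ f → (∀ i → ¬ f i ≡ x) →
              Injective _≡_ _≡_ (x ∷ f)
∷-injective f-inj fresh {zero}  {zero}  _  = refl
∷-injective f-inj fresh {zero}  {suc j} eq = contradiction (sym eq) (fresh j)
∷-injective f-inj fresh {suc i} {zero}  eq = contradiction eq (fresh i)
∷-injective f-inj fresh {suc i} {suc j} eq = cong suc (f-inj eq)

∷₃-injective : ∀ {a b c : X} → ¬ a ≡ b → ¬ a ≡ c → ¬ b ≡ c →
               Injective _≡_ _≡_ (a ∷ b ∷ c ∷ [])
∷₃-injective {b = b} {c} a≢b a≢c b≢c =
  ∷-injective {f = b ∷ c ∷ []}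
    (∷-injective {f = c ∷ []} (∷-injective []-injective λ ()) λ { zero → b≢c ∘ sym })
    λ { zero → a≢b ∘ sym ; (suc zero) → a≢c ∘ sym }

module _ {A : Adjacency (Fin n)} (A-sym : IsSymmetric A) where

  []-independent : IsIndependent A []
  []-independent = []-injective , λ ()

  ∷-independent : ∀ {v} {f : Fin k → Fin n} → IsIndependent A f →
                  (∀ i → A v (f i) ≡ false × ¬ f i ≡ v) → IsIndependent A (v ∷ f)
  ∷-independent {v = v} {f} (f-inj , f-indep) fresh = ∷-injective f-inj (proj₂ ∘ fresh) , indep
    where
    indep : ∀ i j → ¬ i ≡ j → A ((v ∷ f) i) ((v ∷ f) j) ≡ false
    indep zero    zero    i≢j = contradiction refl i≢j
    indep zero    (suc j) _   = proj₁ (fresh j)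
    indep (suc i) zero    _   = trans (A-sym (f i) v) (proj₁ (fresh i))
    indep (suc i) (suc j) i≢j = f-indep i j (i≢j ∘ cong suc)

  _∖N[_] : (Fin n → Bool) → Fin n → Fin n → Bool
  (S ∖N[ v ]) u = S u ∧ not (A v u) ∧ not (does (u ≟ v))

  ∖N-true : ∀ S v u → (S ∖N[ v ]) u ≡ true → S u ≡ true × A v u ≡ false × ¬ u ≡ v
  ∖N-true S v u _ with S u | A v u | u ≟ v
  ... | true | false | no u≢v = refl , refl , u≢v

  count-≤-∖N : ∀ {W S : Fin n → Bool} v → (∀ u → S u ≡ true → W u ≡ true) →
               count S ≤ count (S ∖N[ v ]) + suc (count (λ u → W u ∧ A v u))
  count-≤-∖N {W = W} {S} v S⊆W = begin
    count S
      ≤⟨ ∑-mono-≤ (λ u → covered (S u) (W u) (A v u) (does (u ≟ v)) (S⊆W u)) ⟩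
    ∑[ u < _ ] (𝟙 ((S ∖N[ v ]) u) + (𝟙 (does (u ≟ v)) + 𝟙 (W u ∧ A v u)))
      ≡⟨ ∑-distrib-+ (𝟙 ∘ (S ∖N[ v ])) _ ⟩
    count (S ∖N[ v ]) + ∑[ u < _ ] (𝟙 (does (u ≟ v)) + 𝟙 (W u ∧ A v u))
      ≡⟨ cong (count (S ∖N[ v ]) +_) (∑-distrib-+ (λ u → 𝟙 (does (u ≟ v))) _) ⟩
    count (S ∖N[ v ]) + (count (λ u → does (u ≟ v)) + count (λ u → W u ∧ A v u))
      ≡⟨ cong (λ c → count (S ∖N[ v ]) + (c + count (λ u → W u ∧ A v u))) (count-singleton v) ⟩
    count (S ∖N[ v ]) + suc (count (λ u → W u ∧ A v u)) ∎
    where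
    open ≤-Reasoning
    covered : ∀ s w a e → (s ≡ true → w ≡ true) →
              𝟙 s ≤ 𝟙 (s ∧ not a ∧ not e) + (𝟙 e + 𝟙 (w ∧ a))
    covered false _     _     _     _   = z≤n
    covered true  false _     _     s⇒w = contradiction (s⇒w refl) λ ()
    covered true  true  false false _   = s≤s z≤n
    covered true  true  false true  _   = s≤s z≤n
    covered true  true  true  false _   = s≤s z≤n
    covered true  true  true  true  _   = s≤s z≤n

  sparse⇒independent : ∀ d j {W S : Fin n → Bool} → (∀ u → S u ≡ true → W u ≡ true) →
    (∀ v → S v ≡ true → count (λ u → W u ∧ A v u) < d) → d * j < count S →
    ∃ λ (f : Fin (suc j) → Fin n) → IsIndependent A f × (∀ i → S (f i) ≡ true)
  sparse⇒independent d j {S = S} S⊆W sparse big with count>0⇒∃ S (≤-<-trans z≤n big)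
  sparse⇒independent d zero S⊆W sparse big | v , Sv =
    v ∷ [] , ∷-independent []-independent (λ ()) , λ { zero → Sv }
  sparse⇒independent d (suc j) {W} {S} S⊆W sparse big | v , Sv =
    v ∷ f , ∷-independent f-indep fresh , v∷f⊆S
    where
    big′ : d * j < count (S ∖N[ v ])
    big′ = +-cancelʳ-< d (d * j) (count (S ∖N[ v ])) (begin-strict
      d * j + d                                            ≡⟨ +-comm (d * j) d ⟩
      d + d * j                                            ≡⟨ *-suc d j ⟨
      d * suc j                                            <⟨ big ⟩
      count S                                              ≤⟨ count-≤-∖N v S⊆W ⟩
      count (S ∖N[ v ]) + suc (count (λ u → W u ∧ A v u))  ≤⟨ +-monoʳ-≤ _ (sparse v Sv) ⟩
      count (S ∖N[ v ]) + d                                ∎)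
      where open ≤-Reasoning
    rest : ∃ λ (f : Fin (suc j) → Fin n) → IsIndependent A f × (∀ i → (S ∖N[ v ]) (f i) ≡ true)
    rest = sparse⇒independent d j (λ u → S⊆W u ∘ proj₁ ∘ ∖N-true S v u)
                                   (λ u → sparse u ∘ proj₁ ∘ ∖N-true S v u) big′
    f : Fin (suc j) → Fin n
    f = proj₁ rest
    f-indep : IsIndependent A f
    f-indep = proj₁ (proj₂ rest)
    f⊆S∖N[v] : ∀ i → (S ∖N[ v ]) (f i) ≡ true
    f⊆S∖N[v] = proj₂ (proj₂ rest)
    fresh : ∀ i → A v (f i) ≡ false × ¬ f i ≡ v
    fresh i = proj₂ (∖N-true S v (f i) (f⊆S∖N[v] i))
    v∷f⊆S : ∀ i → S ((v ∷ f) i) ≡ true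
    v∷f⊆S zero    = Sv
    v∷f⊆S (suc i) = proj₁ (∖N-true S v (f i) (f⊆S∖N[v] i))

module _ {A : Adjacency (Fin n)} (A-sym : IsSymmetric A) (α≤m : ¬ HasIndependent A (suc m)) where

  sparse⇒count-≤ : ∀ d {W S : Fin n → Bool} → (∀ u → S u ≡ true → W u ≡ true) →
    (∀ v → S v ≡ true → count (λ u → W u ∧ A v u) < d) → count S ≤ d * m
  sparse⇒count-≤ d S⊆W sparse = ≮⇒≥ λ big →
    let f , f-indep , _ = sparse⇒independent A-sym d m S⊆W sparse big in α≤m (f , f-indep)

  count-independentSet-≤ : ∀ {S} → IsIndependentSet A S → count S ≤ m
  count-independentSet-≤ {S} S-indep =
    subst (count S ≤_) (*-identityˡ m) (sparse⇒count-≤ 1 (λ _ → id) isolated)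
    where
    isolated : ∀ v → S v ≡ true → count (λ u → S u ∧ A v u) < 1
    isolated v Sv =
      s≤s (≤-trans (∑-≤-const 0 λ u → ≤-reflexive (cong 𝟙 (no-edge u))) (≤-reflexive (*-zeroʳ n)))
      where
      no-edge : ∀ u → S u ∧ A v u ≡ false
      no-edge u with S u in Su
      ... | false = refl
      ... | true  = S-indep v u Sv Su

  count-lowDegree-≤ : ∀ d → count (λ v → degree A v <ᵇ d) ≤ d * m
  count-lowDegree-≤ d = sparse⇒count-≤ d (λ _ _ → refl) (λ v → <ᵇ-true (degree A v) d)

-- Exhaustive search

-- Function types lack extensionality, so a search through them only succeeds for predicates
-- respecting pointwise equality; hence the relation.
Searchable : (X : Set) → Rel X 0ℓ → Set₁
Searchable X _≈_ = ∀ {P : Pred X 0ℓ} → P Respects _≈_ → Decidable P → Dec (∃ P)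

Exhaustible : Set → Set₁
Exhaustible X = ∀ {P : Pred X 0ℓ} → Decidable P → Dec (∀ x → P x)

search-Fin : Searchable (Fin n) _≡_
search-Fin _ = any?

search-Bool : Searchable Bool _≡_
search-Bool _ P? = map′ (λ { (inj₁ p) → true , p ; (inj₂ p) → false , p })
                        (λ { (true , p) → inj₁ p ; (false , p) → inj₂ p })
                        (P? true ⊎-dec P? false)

search-→ : Reflexive _≈_ → Searchable X _≈_ → ∀ m → Searchable (Fin m → X) (Pointwise _≈_)
search-→ ≈-refl search zero P-resp P? =
  map′ (λ p → [] , p) (λ (f , p) → P-resp (λ ()) p) (P? [])
search-→ ≈-refl search (suc m) P-resp P? =
  map′ (λ (x , f , p) → x ∷ f , p)
       (λ (f , p) → f zero , f ∘ suc , P-resp (λ { zero → ≈-refl ; (suc i) → ≈-refl }) p)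
       (search (λ x≈y (f , p) → f , P-resp (λ { zero → x≈y ; (suc i) → ≈-refl }) p)
               (λ x → search-→ ≈-refl search m
                        (λ f≈g → P-resp λ { zero → ≈-refl ; (suc i) → f≈g i }) (λ f → P? (x ∷ f))))

search-Cell→ : Reflexive _≈_ → Searchable X _≈_ →
               Searchable (Cell n n → X) (λ f g → ∀ u → f u ≈ g u)
search-Cell→ {n = n} ≈-refl search P-resp P? =
  map′ (λ (f , p) → uncurry f , p) (λ (f , p) → curry f , p)
       (search-→ (λ _ → ≈-refl) (search-→ ≈-refl search n) n
                 (λ f≈g → P-resp λ (x , y) → f≈g x y) (P? ∘ uncurry))

search-∀ : Symmetric _≈_ → Searchable X _≈_ → ∀ {P : Pred X 0ℓ} → P Respects _≈_ → Decidable P →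
           Dec (∀ x → P x)
search-∀ ≈-sym search P-resp P? =
  map′ (λ ∄¬P x → decidable-stable (P? x) (λ ¬Px → ∄¬P (x , ¬Px)))
       (λ ∀P (x , ¬Px) → ¬Px (∀P x))
       (¬? (search (λ x≈y ¬Px Py → ¬Px (P-resp (≈-sym x≈y) Py)) (¬? ∘ P?)))

all-cells? : Exhaustible (Cell n n)
all-cells? P? = map′ (λ all (x , y) → all x y) (λ all x y → all (x , y))
                     (all? λ x → all? λ y → P? (x , y))

injective? : (f : Fin k → Fin n) → Dec (Injective _≡_ _≡_ f)
injective? f = map′ (λ inj {i} {j} → inj i j) (λ inj i j → inj)
                    (all? λ i → all? λ j → (f i ≟ f j) →-dec (i ≟ j))

isIndependent? : (A : Adjacency (Fin n)) (f : Fin k → Fin n) → Dec (IsIndependent A f)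
isIndependent? A f =
  injective? f ×-dec (all? λ i → all? λ j → ¬? (i ≟ j) →-dec (A (f i) (f j) ≟ᵇ false))

isIndependent-resp : (A : Adjacency (Fin n)) → IsIndependent {k = k} A Respects (Pointwise _≡_)
isIndependent-resp A f≗g (f-inj , f-indep) =
  (λ {i} {j} gᵢ≡gⱼ → f-inj (trans (f≗g i) (trans gᵢ≡gⱼ (sym (f≗g j))))) ,
  (λ i j i≢j → subst₂ (λ u v → A u v ≡ false) (f≗g i) (f≗g j) (f-indep i j i≢j))

hasIndependent? : (A : Adjacency (Fin n)) → ∀ k → Dec (HasIndependent A k)
hasIndependent? A k = search-→ refl search-Fin k (isIndependent-resp A) (isIndependent? A)

symmetric? : Exhaustible X → (A : Adjacency X) → Dec (IsSymmetric A)
symmetric? all? A = all? λ u → all? λ v → A u v ≟ᵇ A v u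

irreflexive? : Exhaustible X → (A : Adjacency X) → Dec (IsIrreflexive A)
irreflexive? all? A = all? λ u → A u u ≟ᵇ false

-- Grids

row : Adjacency (Cell n n) → Fin n → Adjacency (Fin n)
row A y x x′ = A (x , y) (x′ , y)

column : Adjacency (Cell n n) → Fin n → Adjacency (Fin n)
column A x y y′ = A (x , y) (x , y′)

OnLines : Adjacency (Cell n n) → Set
OnLines A = ∀ u v → A u v ≡ true → proj₁ u ≡ proj₁ v ⊎ proj₂ u ≡ proj₂ v

Coclique : Adjacency (Cell n n) → ℕ → Set
Coclique A k = (∃[ y ] HasIndependent (row A y) k) ⊎ (∃[ x ] HasIndependent (column A x) k)

-- The image of AC6 under the columns a, b, c and the rows p, q, s.
Hexagon : Adjacency (Cell n n) → Set
Hexagon A = ∃[ a ] ∃[ b ] ∃[ c ] ∃[ p ] ∃[ q ] ∃[ s ]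
  (A (a , p) (b , p) ≡ true × A (b , p) (b , q) ≡ true × A (b , q) (c , q) ≡ true ×
   A (c , q) (c , s) ≡ true × A (c , s) (a , s) ≡ true × A (a , s) (a , p) ≡ true)

onLines? : (A : Adjacency (Cell n n)) → Dec (OnLines A)
onLines? A = all-cells? λ u → all-cells? λ v →
  (A u v ≟ᵇ true) →-dec ((proj₁ u ≟ proj₁ v) ⊎-dec (proj₂ u ≟ proj₂ v))

coclique? : (A : Adjacency (Cell n n)) → ∀ k → Dec (Coclique A k)
coclique? A k = (any? λ y → hasIndependent? (row A y) k) ⊎-dec (any? λ x → hasIndependent? (column A x) k)

hexagon? : (A : Adjacency (Cell n n)) → Dec (Hexagon A)
hexagon? A = any? λ a → any? λ b → any? λ c → any? λ p → any? λ q → any? λ s →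
  (A (a , p) (b , p) ≟ᵇ true) ×-dec (A (b , p) (b , q) ≟ᵇ true) ×-dec (A (b , q) (c , q) ≟ᵇ true) ×-dec
  (A (c , q) (c , s) ≟ᵇ true) ×-dec (A (c , s) (a , s) ≟ᵇ true) ×-dec (A (a , s) (a , p) ≟ᵇ true)

module _ (G : SpanningGrid n) where

  embeds⇒hexagon : Embeds AC6 G → Hexagon (gadj G)
  embeds⇒hexagon (φc , φr , _ , _ , e₁ ∷ᴬ e₂ ∷ᴬ e₃ ∷ᴬ e₄ ∷ᴬ e₅ ∷ᴬ e₆ ∷ᴬ []ᴬ) =
    φc zero , φc (suc zero) , φc (suc (suc zero)) , φr zero , φr (suc zero) , φr (suc (suc zero)) ,
    e₁ , e₂ , e₃ , e₄ , e₅ , e₆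

  hexagon⇒embeds : Hexagon (gadj G) → Embeds AC6 G
  hexagon⇒embeds (a , b , c , p , q , s , e₁ , e₂ , e₃ , e₄ , e₅ , e₆) =
    a ∷ b ∷ c ∷ [] , p ∷ q ∷ s ∷ [] ,
    ∷₃-injective (distinct-columns e₁) (distinct-columns e₅ ∘ sym) (distinct-columns e₃) ,
    ∷₃-injective (distinct-rows e₂) (distinct-rows e₆ ∘ sym) (distinct-rows e₄) ,
    e₁ ∷ᴬ e₂ ∷ᴬ e₃ ∷ᴬ e₄ ∷ᴬ e₅ ∷ᴬ e₆ ∷ᴬ []ᴬ
    where
    adjacent⇒≢ : ∀ {u v} → gadj G u v ≡ true → ¬ u ≡ v
    adjacent⇒≢ {u} uv refl = contradiction (trans (sym uv) (girrefl G u)) λ ()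
    distinct-columns : ∀ {x x′ y} → gadj G (x , y) (x′ , y) ≡ true → ¬ x ≡ x′
    distinct-columns e refl = adjacent⇒≢ e refl
    distinct-rows : ∀ {x y y′} → gadj G (x , y) (x , y′) ≡ true → ¬ y ≡ y′
    distinct-rows e refl = adjacent⇒≢ e refl

square-≤ : ∀ d a b → d * d ≤ a * b + (d * d * 𝟙 (a <ᵇ d) + d * d * 𝟙 (b <ᵇ d))
square-≤ d a b with a <ᵇ d in a<d | b <ᵇ d in b<d
... | true  | _     = ≤-trans (m≤m*n (d * d) 1) (≤-trans (m≤m+n _ _) (m≤n+m _ (a * b)))
... | false | true  = ≤-trans (m≤m*n (d * d) 1) (≤-trans (m≤n+m _ _) (m≤n+m _ (a * b)))
... | false | false = ≤-trans (*-mono-≤ (<ᵇ-false a d a<d) (<ᵇ-false b d b<d)) (m≤m+n (a * b) _)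

module HexagonFree {N} (G : SpanningGrid N) {m} (no-hexagon : ¬ Hexagon (gadj G))
                   (no-coclique : ¬ HasCoclique G (suc m)) where

  vdeg hdeg : Fin N → Fin N → ℕ
  vdeg x y = degree (column (gadj G) x) y
  hdeg x y = degree (row (gadj G) y) x

  cherries : ℕ
  cherries = ∑[ x < N ] ∑[ y < N ] (vdeg x y * hdeg x y)

  corner : Fin N → Fin N → Fin N → Fin N → Bool
  corner ρ c x y = gadj G (x , y) (x , ρ) ∧ gadj G (x , y) (c , y)

  cherries-by-ends : cherries ≡ ∑[ ρ < N ] ∑[ c < N ] ∑[ x < N ] ∑[ y < N ] 𝟙 (corner ρ c x y)
  cherries-by-ends = begin
    ∑[ x < N ] ∑[ y < N ] (vdeg x y * hdeg x y)
      ≡⟨ sum-cong-≗ (λ x → sum-cong-≗ λ y → count-*-count (column (gadj G) x y) (row (gadj G) y x)) ⟩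
    ∑[ x < N ] ∑[ y < N ] ∑[ ρ < N ] ∑[ c < N ] 𝟙 (corner ρ c x y)
      ≡⟨ sum-cong-≗ (λ x → ∑-comm λ y ρ → ∑[ c < N ] 𝟙 (corner ρ c x y)) ⟩
    ∑[ x < N ] ∑[ ρ < N ] ∑[ y < N ] ∑[ c < N ] 𝟙 (corner ρ c x y)
      ≡⟨ sum-cong-≗ (λ x → sum-cong-≗ λ ρ → ∑-comm λ y c → 𝟙 (corner ρ c x y)) ⟩
    ∑[ x < N ] ∑[ ρ < N ] ∑[ c < N ] ∑[ y < N ] 𝟙 (corner ρ c x y)
      ≡⟨ ∑-comm (λ x ρ → ∑[ c < N ] ∑[ y < N ] 𝟙 (corner ρ c x y)) ⟩
    ∑[ ρ < N ] ∑[ x < N ] ∑[ c < N ] ∑[ y < N ] 𝟙 (corner ρ c x y)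
      ≡⟨ sum-cong-≗ (λ ρ → ∑-comm λ x c → ∑[ y < N ] 𝟙 (corner ρ c x y)) ⟩
    ∑[ ρ < N ] ∑[ c < N ] ∑[ x < N ] ∑[ y < N ] 𝟙 (corner ρ c x y) ∎
    where open ≡-Reasoning

  module _ (ρ c : Fin N) where

    Linked : Fin N → Fin N → Set
    Linked x y = ∃ λ y′ → corner ρ c x y′ ≡ true × gadj G (c , y) (c , y′) ≡ true

    linked? : ∀ x y → Dec (Linked x y)
    linked? x y = any? λ y′ → (corner ρ c x y′ ≟ᵇ true) ×-dec (gadj G (c , y) (c , y′) ≟ᵇ true)

    linked : Fin N → Fin N → Bool
    linked x y = does (linked? x y)

    unlinked-independent : ∀ x →
      IsIndependentSet (column (gadj G) c) (λ y → corner ρ c x y ∧ not (linked x y))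
    unlinked-independent x u v Su Sv with gadj G (c , u) (c , v) in uv
    ... | false = refl
    ... | true  = contradiction (subst (λ b → not b ≡ true) u-linked (proj₂ (∧-true Su))) λ ()
      where
      u-linked : linked x u ≡ true
      u-linked = dec-true (linked? x u) (v , proj₁ (∧-true Sv) , uv)

    linked-independent : ∀ y → IsIndependentSet (row (gadj G) ρ) (λ x → corner ρ c x y ∧ linked x y)
    linked-independent y u v Su Sv with gadj G (u , ρ) (v , ρ) in uv
    ... | false = refl
    ... | true  = contradiction hexagon no-hexagon
      where
      hexagon : Hexagon (gadj G)
      hexagon with does-true (linked? u y) (proj₂ (∧-true Su)) | ∧-true (proj₁ (∧-true Sv))
      ... | y′ , u-corner , yy′ | v-vertical , v-horizontal =
        let u-vertical , u-horizontal = ∧-true u-corner in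
        u , v , c , ρ , y , y′ , uv , trans (gsym G _ _) v-vertical , v-horizontal ,
        yy′ , trans (gsym G _ _) u-horizontal , u-vertical

    corners-≤ : ∑[ x < N ] ∑[ y < N ] 𝟙 (corner ρ c x y) ≤ N * m + N * m
    corners-≤ = begin
      ∑[ x < N ] ∑[ y < N ] 𝟙 (corner ρ c x y)
        ≡⟨ sum-cong-≗ (λ x → sum-cong-≗ λ y → 𝟙-split (corner ρ c x y) (linked x y)) ⟩
      ∑[ x < N ] ∑[ y < N ] (𝟙 (unlinked x y) + 𝟙 (linked-corner x y))
        ≡⟨ ∑∑-distrib-+ (λ x y → 𝟙 (unlinked x y)) _ ⟩
      ∑[ x < N ] ∑[ y < N ] 𝟙 (unlinked x y) + ∑[ x < N ] ∑[ y < N ] 𝟙 (linked-corner x y)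
        ≡⟨ cong (∑[ x < N ] ∑[ y < N ] 𝟙 (unlinked x y) +_)
                (∑-comm λ x y → 𝟙 (linked-corner x y)) ⟩
      ∑[ x < N ] ∑[ y < N ] 𝟙 (unlinked x y) + ∑[ y < N ] ∑[ x < N ] 𝟙 (linked-corner x y)
        ≤⟨ +-mono-≤ (∑-≤-const m λ x → count-independentSet-≤ (λ _ _ → gsym G _ _)
                                          (λ I → no-coclique (inj₂ (c , I))) (unlinked-independent x))
                    (∑-≤-const m λ y → count-independentSet-≤ (λ _ _ → gsym G _ _)
                                          (λ I → no-coclique (inj₁ (ρ , I))) (linked-independent y)) ⟩
      N * m + N * m ∎
      where
      open ≤-Reasoning
      unlinked linked-corner : Fin N → Fin N → Bool
      unlinked x y = corner ρ c x y ∧ not (linked x y)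
      linked-corner x y = corner ρ c x y ∧ linked x y

  cherries-≤ : cherries ≤ N * (N * (N * m + N * m))
  cherries-≤ = ≤-trans (≤-reflexive cherries-by-ends)
                       (∑-≤-const _ λ ρ → ∑-≤-const _ λ c → corners-≤ ρ c)

  low-degrees-≤ : ∀ d (F : Fin N → Fin N → Bool) → (∀ x → count (F x) ≤ d * m) →
                  ∑[ x < N ] ∑[ y < N ] (d * d * 𝟙 (F x y)) ≤ d * d * (N * (d * m))
  low-degrees-≤ d F F≤ = begin
    ∑[ x < N ] ∑[ y < N ] (d * d * 𝟙 (F x y))
      ≡⟨ sum-cong-≗ (λ x → *-distribˡ-sum {N} (d * d) (𝟙 ∘ F x)) ⟨
    ∑[ x < N ] (d * d * count (F x))
      ≡⟨ *-distribˡ-sum {N} (d * d) (count ∘ F) ⟨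
    d * d * ∑[ x < N ] count (F x)
      ≤⟨ *-monoʳ-≤ (d * d) (∑-≤-const (d * m) F≤) ⟩
    d * d * (N * (d * m)) ∎
    where open ≤-Reasoning

  cherries-≥ : ∀ d → N * (N * (d * d)) ≤ cherries + (d * d * (N * (d * m)) + d * d * (N * (d * m)))
  cherries-≥ d = begin
    N * (N * (d * d))
      ≡⟨ trans (sum-cong-≗ {N} λ x → ∑-const N (d * d)) (∑-const N (N * (d * d))) ⟨
    ∑[ x < N ] ∑[ y < N ] (d * d)
      ≤⟨ ∑-mono-≤ (λ x → ∑-mono-≤ λ y → square-≤ d (vdeg x y) (hdeg x y)) ⟩
    ∑[ x < N ] ∑[ y < N ] (vdeg x y * hdeg x y + (vlow x y + hlow x y))
      ≡⟨ ∑∑-distrib-+ (λ x y → vdeg x y * hdeg x y) _ ⟩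
    cherries + ∑[ x < N ] ∑[ y < N ] (vlow x y + hlow x y)
      ≡⟨ cong (cherries +_) (∑∑-distrib-+ vlow hlow) ⟩
    cherries + (∑[ x < N ] ∑[ y < N ] vlow x y + ∑[ x < N ] ∑[ y < N ] hlow x y)
      ≡⟨ cong (λ t → cherries + (∑[ x < N ] ∑[ y < N ] vlow x y + t)) (∑-comm hlow) ⟩
    cherries + (∑[ x < N ] ∑[ y < N ] vlow x y + ∑[ y < N ] ∑[ x < N ] hlow x y)
      ≤⟨ +-monoʳ-≤ cherries (+-mono-≤
           (low-degrees-≤ d (λ x y → vdeg x y <ᵇ d) λ x →
             count-lowDegree-≤ (λ _ _ → gsym G _ _) (λ I → no-coclique (inj₂ (x , I))) d)
           (low-degrees-≤ d (λ y x → hdeg x y <ᵇ d) λ y →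
             count-lowDegree-≤ (λ _ _ → gsym G _ _) (λ I → no-coclique (inj₁ (y , I))) d)) ⟩
    cherries + (d * d * (N * (d * m)) + d * d * (N * (d * m))) ∎
    where
    open ≤-Reasoning
    vlow hlow : Fin N → Fin N → ℕ
    vlow x y = d * d * 𝟙 (vdeg x y <ᵇ d)
    hlow x y = d * d * 𝟙 (hdeg x y <ᵇ d)

  size-bound : ∀ d →
    N * (N * (d * d)) ≤ N * (N * (N * m + N * m)) + (d * d * (N * (d * m)) + d * d * (N * (d * m)))
  size-bound d = ≤-trans (cherries-≥ d) (+-monoˡ-≤ _ cherries-≤)

grProp-AC6 : ∀ {N} m d →
  N * (N * (N * m + N * m)) + (d * d * (N * (d * m)) + d * d * (N * (d * m))) < N * (N * (d * d)) →
  GrProp AC6 (suc m) N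
grProp-AC6 m d violated G with hexagon? (gadj G) | coclique? (gadj G) (suc m)
... | yes hexagon    | _              = inj₁ (hexagon⇒embeds G hexagon)
... | no  _          | yes coclique   = inj₂ coclique
... | no  no-hexagon | no no-coclique =
  contradiction (HexagonFree.size-bound G no-hexagon no-coclique d) (<⇒≱ violated)

-- Dividing by N d² leaves 32k²m + 2dm < 4kd, which holds as d > 16k² and m < k.
size-bound-violated : ∀ m → let k = suc m ; d = suc (16 * k * k) ; N = 4 * k * d in
  N * (N * (N * m + N * m)) + (d * d * (N * (d * m)) + d * d * (N * (d * m))) < N * (N * (d * d))
size-bound-violated m =
  let k = suc m ; d = suc (16 * k * k) in
  subst₂ _<_ (sym (rhs k d m)) (sym (lhs k d))
         (*-monoʳ-< (4 * k * d * d * d) (<-≤-trans (m<m+n _ (s≤s z≤n)) (≤-reflexive (sym (gap m)))))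
  where
  lhs : ∀ k d → let N = 4 * k * d in N * (N * (d * d)) ≡ N * d * d * (4 * k * d)
  lhs = solve-∀
  rhs : ∀ k d m → let N = 4 * k * d in
    N * (N * (N * m + N * m)) + (d * d * (N * (d * m)) + d * d * (N * (d * m))) ≡
    N * d * d * (32 * k * k * m + 2 * d * m)
  rhs = solve-∀
  gap : ∀ m → let k = suc m ; d = suc (16 * k * k) in
    4 * k * d ≡ 32 * k * k * m + 2 * d * m + 2 * suc (32 * k * k + k)
  gap = solve-∀

gr-AC6-≤ : ∀ m → let k = suc m in GrProp AC6 k (4 * k * suc (16 * k * k))
gr-AC6-≤ m = grProp-AC6 m (suc (16 * suc m * suc m)) (size-bound-violated m)

4k[16k²+1]≤68k³ : ∀ m → let k = suc m in 4 * k * suc (16 * k * k) ≤ 68 * k ^ 3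
4k[16k²+1]≤68k³ m = let k = suc m in
  ≤-trans (m≤m+n (4 * k * suc (16 * k * k)) (4 * k * m * (m + 2))) (≤-reflexive (sym (identity m)))
  where
  identity : ∀ m → let k = suc m in 68 * (k * (k * (k * 1))) ≡ 4 * k * suc (16 * k * k) + 4 * k * m * (m + 2)
  identity = solve-∀

-- The square of a graph

does-≟-sym : ∀ (i j : Fin n) → does (i ≟ j) ≡ does (j ≟ i)
does-≟-sym i j with i ≟ j | j ≟ i
... | yes _   | yes _   = refl
... | no  _   | no  _   = refl
... | yes i≡j | no  j≢i = contradiction (sym i≡j) j≢i
... | no  i≢j | yes j≡i = contradiction (sym j≡i) i≢j

module _ (G : SimpleGraph n) where

  □-adj : Adjacency (Cell n n)
  □-adj (x , y) (x′ , y′) = (does (y ≟ y′) ∧ adj G x x′) ∨ (does (x ≟ x′) ∧ adj G y y′)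

  □-row : ∀ y → row □-adj y ≐ adj G
  □-row y x x′ rewrite dec-true (y ≟ y) refl | irrefl G y | ∧-zeroʳ (does (x ≟ x′)) =
    ∨-identityʳ (adj G x x′)

  □-column : ∀ x → column □-adj x ≐ adj G
  □-column x y y′ rewrite irrefl G x | ∧-zeroʳ (does (y ≟ y′)) | dec-true (x ≟ x) refl = refl

  _□ : SpanningGrid n
  _□ = record { gadj = □-adj ; gsym = □-sym ; girrefl = □-irrefl ; gline = □-line }
    where
    □-sym : IsSymmetric □-adj
    □-sym (x , y) (x′ , y′) rewrite does-≟-sym y y′ | does-≟-sym x x′
                                   | SimpleGraph.sym G x x′ | SimpleGraph.sym G y y′ = refl
    □-irrefl : IsIrreflexive □-adj
    □-irrefl (x , y) = trans (□-row y x x) (irrefl G x)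
    □-line : OnLines □-adj
    □-line (x , y) (x′ , y′) _ with y ≟ y′ | x ≟ x′
    ... | yes y≡y′ | _        = inj₂ y≡y′
    ... | no  _    | yes x≡x′ = inj₁ x≡x′

  □-hexagon⇒triangle : Hexagon □-adj → HasTriangle G
  □-hexagon⇒triangle (a , b , c , p , q , s , ab , _ , bc , _ , ca , _) =
    a , b , c , trans (sym (□-row p a b)) ab , trans (sym (□-row q b c)) bc ,
    trans (SimpleGraph.sym G a c) (trans (sym (□-row s c a)) ca)

gr⇒ramsey : GrProp AC6 k n → RamseyProp k n
gr⇒ramsey gr G with gr (G □)
... | inj₁ embedding      = inj₁ (□-hexagon⇒triangle G (embeds⇒hexagon (G □) embedding))
... | inj₂ (inj₁ (y , I)) = inj₂ (independent-≐ (□-row G y) I)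
... | inj₂ (inj₂ (x , I)) = inj₂ (independent-≐ (□-column G x) I)

Triangle : Adjacency (Fin n) → Set
Triangle A = ∃[ a ] ∃[ b ] ∃[ c ] (A a b ≡ true × A b c ≡ true × A a c ≡ true)

triangle? : (A : Adjacency (Fin n)) → Dec (Triangle A)
triangle? A = any? λ a → any? λ b → any? λ c →
  (A a b ≟ᵇ true) ×-dec (A b c ≟ᵇ true) ×-dec (A a c ≟ᵇ true)

search-adjacency-Fin : Searchable (Adjacency (Fin n)) _≐_
search-adjacency-Fin {n} = search-→ (λ _ → refl) (search-→ refl search-Bool n) n

search-adjacency-Cell : Searchable (Adjacency (Cell n n)) _≐_
search-adjacency-Cell = search-Cell→ (λ _ → refl) (search-Cell→ refl search-Bool)

module _ {A B : Adjacency X} (A≐B : A ≐ B) where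

  edge-≐ : ∀ {u v b} → A u v ≡ b → B u v ≡ b
  edge-≐ = trans (sym (A≐B _ _))

  symmetric-≐ : IsSymmetric B → IsSymmetric A
  symmetric-≐ B-sym u v = trans (A≐B u v) (trans (B-sym u v) (sym (A≐B v u)))

  irreflexive-≐ : IsIrreflexive B → IsIrreflexive A
  irreflexive-≐ B-irr u = trans (A≐B u u) (B-irr u)

triangle-≐ : {A B : Adjacency (Fin n)} → A ≐ B → Triangle A → Triangle B
triangle-≐ A≐B (a , b , c , ab , bc , ac) = a , b , c , edge-≐ A≐B ab , edge-≐ A≐B bc , edge-≐ A≐B ac

module _ {A B : Adjacency (Cell n n)} (A≐B : A ≐ B) where

  onLines-≐ : OnLines B → OnLines A
  onLines-≐ B-line u v uv = B-line u v (edge-≐ A≐B uv)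

  hexagon-≐ : Hexagon A → Hexagon B
  hexagon-≐ (a , b , c , p , q , s , e₁ , e₂ , e₃ , e₄ , e₅ , e₆) =
    a , b , c , p , q , s , edge-≐ A≐B e₁ , edge-≐ A≐B e₂ , edge-≐ A≐B e₃ ,
    edge-≐ A≐B e₄ , edge-≐ A≐B e₅ , edge-≐ A≐B e₆

  coclique-≐ : Coclique A k → Coclique B k
  coclique-≐ = Sum.map (λ (y , I) → y , independent-≐ (λ x x′ → A≐B (x , y) (x′ , y)) I)
                       (λ (x , I) → x , independent-≐ (λ y y′ → A≐B (x , y) (x , y′)) I)

ramsey? : ∀ k n → Dec (RamseyProp k n)
ramsey? k n = map′ (λ ramsey G → ramsey (adj G) (SimpleGraph.sym G) (irrefl G))
                   (λ ramsey A A-sym A-irr → ramsey (record { adj = A ; sym = A-sym ; irrefl = A-irr }))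
                   (search-∀ ≐-sym search-adjacency-Fin P-resp P?)
  where
  P : Pred (Adjacency (Fin n)) 0ℓ
  P A = IsSymmetric A → IsIrreflexive A → Triangle A ⊎ HasIndependent A k
  P-resp : P Respects _≐_
  P-resp A≐B PA B-sym B-irr = Sum.map (triangle-≐ A≐B) (independent-≐ A≐B)
                                      (PA (symmetric-≐ A≐B B-sym) (irreflexive-≐ A≐B B-irr))
  P? : Decidable P
  P? A = symmetric? all? A →-dec (irreflexive? all? A →-dec (triangle? A ⊎-dec hasIndependent? A k))

gr? : ∀ k n → Dec (GrProp AC6 k n)
gr? k n = map′ (λ gr G → Sum.map₁ (hexagon⇒embeds G) (gr (gadj G) (gsym G) (girrefl G) (gline G)))
               (λ gr A A-sym A-irr A-line →
                 let G = record { gadj = A ; gsym = A-sym ; girrefl = A-irr ; gline = A-line }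
                 in Sum.map₁ (embeds⇒hexagon G) (gr G))
               (search-∀ ≐-sym search-adjacency-Cell P-resp P?)
  where
  P : Pred (Adjacency (Cell n n)) 0ℓ
  P A = IsSymmetric A → IsIrreflexive A → OnLines A → Hexagon A ⊎ Coclique A k
  P-resp : P Respects _≐_
  P-resp A≐B PA B-sym B-irr B-line = Sum.map (hexagon-≐ A≐B) (coclique-≐ A≐B)
    (PA (symmetric-≐ A≐B B-sym) (irreflexive-≐ A≐B B-irr) (onLines-≐ A≐B B-line))
  P? : Decidable P
  P? A = symmetric? all-cells? A →-dec (irreflexive? all-cells? A →-dec
           (onLines? A →-dec (hexagon? A ⊎-dec coclique? A k)))

least-≤ : {P : Pred ℕ 0ℓ} → Decidable P → ∀ b → P b → ∃ λ a → a ≤ b × IsLeast P a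
least-≤ {P} P? = <-rec LeastBelow step
  where
  LeastBelow : ℕ → Set
  LeastBelow b = P b → ∃ λ a → a ≤ b × IsLeast P a
  step : ∀ b → (∀ {c} → c < b → LeastBelow c) → LeastBelow b
  step b smaller Pb with anyUpTo? P? b
  ... | yes (c , c<b , Pc) = let a , a≤c , a-least = smaller c<b Pc in a , ≤-trans a≤c (<⇒≤ c<b) , a-least
  ... | no  none           = b , ≤-refl , Pb , λ c c<b Pc → none (c , c<b , Pc)

theorem4p3 : ∃[ c′ ] ((k : ℕ) → NonZero k →
               ∃[ r ] ∃[ g ] (IsR3 k r × IsGr AC6 k g × r ≤ g × g ≤ c′ * k ^ 3))
theorem4p3 = 68 , λ { (suc m) _ →
  let k = suc m
      g , g≤N , g-least = least-≤ (gr? k) _ (gr-AC6-≤ m)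
      r , r≤g , r-least = least-≤ (ramsey? k) g (gr⇒ramsey (proj₁ g-least))
  in r , g , r-least , g-least , r≤g , ≤-trans g≤N (4k[16k²+1]≤68k³ m) }
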